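{- Let $T$ be an algebraic $\sigma$-theory, let $x\le y$ denote a fixed $\sigma$-equation $P(x,y)$ in two variables, and let $t(x,y)$ be a $\sigma$-term such that $x\le y$ is semi-determined by $t$, i.e. $T\vdash x\le y\Rightarrow t(x,y)\approx y$. Put $v(x,y)=t(t(x,y),x)$. Then: \begin{enumerate} \item For every $\sigma$-equation $E(x,y)$: if $T\vdash E(x,t(x,y))$, then $T\vdash x\le y\Rightarrow E(x,y)$. Conversely, if $x\le y$ is strongly determined by $t$ (i.e. in addition $T\vdash x\le t(x,y)$), then $T\vdash x\le y\Rightarrow E(x,y)$ implies $T\vdash E(x,t(x,y))$. \item If $x\le y$ is determined by $t$ (i.e. in addition $T\vdash t(x,y)\approx y\Rightarrow x\le y$), then $T\vdash x\le x$ if and only if $T\vdash t(x,x)\approx x$. \item If $T\vdash v(x,y)\approx v(y,x)$ or $T\vdash v(x,y)\approx t(v(x,y),y)$, then $T\vdash (x\le y\wedge y\le x)\Rightarrow x\approx y$. \item If $T\vdash x\le t(t(x,y),z)$, then $T\vdash (x\le y\wedge y\le z)\Rightarrow x\le z$. Conversely, if $x\le y$ is strongly determined by $t$, then $T\vdash (x\le y\wedge y\le z)\Rightarrow x\le z$ implies $T\vdash x\le t(t(x,y),z)$. \end{enumerate}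
   Context: A signature $\sigma$ is a set of function symbols with arities; $\sigma$-terms are built from a countably infinite set of variables, constant symbols and function symbols; a $\sigma$-equation is an expression $t_1\approx t_2$ of terms; an algebraic $\sigma$-theory $T$ is a set of $\sigma$-equations, and $T\vdash\phi$ means $\phi$ is derivable from $T$ by the usual equational rules (reflexivity, symmetry, transitivity, substitution of equals into terms, and substitution of terms for variables); equivalently $\phi$ holds in every model of $T$. For a set $T'$ of equations and an equation $P(x_1,\dots,x_n)$, "$T\vdash \bigwedge T'\Rightarrow P$" means: after adjoining pairwise distinct fresh constant symbols $a_1,a_2,\dots$ (not occurring in $\sigma$), $T\cup\{Q(a_1,\dots,a_m)\mid Q(x_1,\dots,x_m)\in T'\}\vdash P(a_1,\dots,a_n)$. A conjunction $(Q_1\wedge\dots\wedge Q_k)\Rightarrow P$ denotes this with $T'=\{Q_1,\dots,Q_k\}$. Writing $x\le z$, $x\le t(x,y)$ etc. means the equation $P$ with the indicated terms substituted. -}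

module Defs where

open import Data.Nat using (ℕ)
open import Data.Fin using (Fin; zero; suc; toℕ)
open import Data.Product using (_×_; _,_; proj₁; proj₂)
open import Data.Sum using (_⊎_; inj₁; inj₂)
open import Data.List using (List)
open import Data.List.Membership.Propositional using (_∈_)

record Signature : Set₁ where
  field
    Sym : Set
    ar  : Sym → ℕ
open Signature public

data Term (σ : Signature) (V : Set) : Set where
  var : V → Term σ V
  app : (f : Sym σ) → (Fin (ar σ f) → Term σ V) → Term σ V

_⟪_⟫ : ∀ {σ V W} → Term σ V → (V → Term σ W) → Term σ W
var x    ⟪ ρ ⟫ = ρ x
app f ts ⟪ ρ ⟫ = app f (λ i → ts i ⟪ ρ ⟫)

Equation : Signature → Set → Set
Equation σ V = Term σ V × Term σ V

_⟪_⟫ₑ : ∀ {σ V W} → Equation σ V → (V → Term σ W) → Equation σ W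
(s , t) ⟪ ρ ⟫ₑ = (s ⟪ ρ ⟫ , t ⟪ ρ ⟫)

-- The variables of the theory: a countably infinite set, namely ℕ.
-- An algebraic σ-theory is a set of σ-equations.
Theory : Signature → Set₁
Theory σ = Equation σ ℕ → Set

infix 4 _⊢_ _⊢_⇒_
infixl 30 _[_,_] _[_,_]ₑ

data _⊢_ {σ : Signature} (T : Theory σ) : Equation σ ℕ → Set where
  axiom  : ∀ {e} → T e → T ⊢ e
  refl≈  : ∀ {s} → T ⊢ (s , s)
  sym≈   : ∀ {s t} → T ⊢ (s , t) → T ⊢ (t , s)
  trans≈ : ∀ {s t u} → T ⊢ (s , t) → T ⊢ (t , u) → T ⊢ (s , u)
  cong≈  : ∀ (f : Sym σ) {ss ts : Fin (ar σ f) → Term σ ℕ} →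
           (∀ i → T ⊢ (ss i , ts i)) → T ⊢ (app f ss , app f ts)
  subst≈ : ∀ {s t} (ρ : ℕ → Term σ ℕ) → T ⊢ (s , t) → T ⊢ (s ⟪ ρ ⟫ , t ⟪ ρ ⟫)

-- Signature σ extended by pairwise distinct fresh constants a₀, a₁, a₂, …
withConsts : Signature → Signature
withConsts σ = record { Sym = Sym σ ⊎ ℕ ; ar = arity }
  where
  arity : Sym σ ⊎ ℕ → ℕ
  arity (inj₁ f) = ar σ f
  arity (inj₂ _) = 0

liftT : ∀ {σ V} → Term σ V → Term (withConsts σ) V
liftT (var x)    = var x
liftT (app f ts) = app (inj₁ f) (λ i → liftT (ts i))

liftE : ∀ {σ V} → Equation σ V → Equation (withConsts σ) V
liftE (s , t) = (liftT s , liftT t)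

fresh : ∀ {σ V} → ℕ → Term (withConsts σ) V
fresh k = app (inj₂ k) (λ ())

ground : ∀ {σ n} → Equation σ (Fin n) → Equation (withConsts σ) ℕ
ground Q = liftE Q ⟪ (λ i → fresh (toℕ i)) ⟫ₑ

data Extend {σ : Signature} (T : Theory σ) {n : ℕ} (T' : List (Equation σ (Fin n)))
     : Equation (withConsts σ) ℕ → Set where
  base : ∀ {e} → T e → Extend T T' (liftE e)
  hyp  : ∀ {Q} → Q ∈ T' → Extend T T' (ground Q)

-- T ⊢ ⋀T' ⇒ P   (all equations in the variables x₁,…,xₙ, i.e. Fin n)
_⊢_⇒_ : ∀ {σ} → Theory σ → ∀ {n} → List (Equation σ (Fin n)) → Equation σ (Fin n) → Set
T ⊢ T' ⇒ P = Extend T T' ⊢ ground P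

embed : ∀ {σ n} → Equation σ (Fin n) → Equation σ ℕ
embed E = E ⟪ (λ i → var (toℕ i)) ⟫ₑ

⟨_,_⟩ : ∀ {σ W} → Term σ W → Term σ W → Fin 2 → Term σ W
⟨ s , u ⟩ zero       = s
⟨ s , u ⟩ (suc zero) = u

_[_,_] : ∀ {σ W} → Term σ (Fin 2) → Term σ W → Term σ W → Term σ W
t [ s , u ] = t ⟪ ⟨ s , u ⟩ ⟫

_[_,_]ₑ : ∀ {σ W} → Equation σ (Fin 2) → Term σ W → Term σ W → Equation σ W
E [ s , u ]ₑ = E ⟪ ⟨ s , u ⟩ ⟫ₑ

x₂ y₂ : ∀ {σ} → Term σ (Fin 2)
x₂ = var zero
y₂ = var (suc zero)

x₃ y₃ z₃ : ∀ {σ} → Term σ (Fin 3)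
x₃ = var zero
y₃ = var (suc zero)
z₃ = var (suc (suc zero))

SemiDetermined : ∀ {σ} → Theory σ → Equation σ (Fin 2) → Term σ (Fin 2) → Set
SemiDetermined T P t = T ⊢ (P Data.List.∷ Data.List.[]) ⇒ (t , y₂)

StronglyDetermined : ∀ {σ} → Theory σ → Equation σ (Fin 2) → Term σ (Fin 2) → Set
StronglyDetermined T P t =
  SemiDetermined T P t × T ⊢ embed (P [ x₂ , t ]ₑ)

Determined : ∀ {σ} → Theory σ → Equation σ (Fin 2) → Term σ (Fin 2) → Set
Determined T P t =
  SemiDetermined T P t × T ⊢ ((t , y₂) Data.List.∷ Data.List.[]) ⇒ P

{-# OPTIONS --safe #-}
-- A derivation from T together with hypotheses Q(a₁,…,aₙ) about fresh constants can be
-- transported along two maps of terms: renaming the constants, and replacing them by σ-terms,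
-- which is sound as soon as every hypothesis becomes a theorem of T (the theorem on constants).
-- The converse halves of (1) and (4), and (2), are the latter with a ↦ x, b ↦ t(x,y)
-- (and c ↦ t(t(x,y),z)), resp. a, b ↦ x. The former makes t(a,b) ≈ b available for every
-- hypothesis a ≤ b, after which (1), (3) and (4) are equational computations such as
-- v(a,b) = t(t(a,b),a) ≈ t(b,a) ≈ a under a ≤ b and b ≤ a.
module Submission where

open import Defs
open import Data.Nat using (ℕ; zero; suc; _+_)
open import Data.Fin using (Fin; zero; suc; toℕ)
open import Data.Product using (_×_; _,_; proj₁; proj₂)
open import Data.Sum using (_⊎_; inj₁; inj₂)
open import Data.List using (List; _∷_; [])
open import Data.List.Relation.Unary.All as All using (All; _∷_; [])
open import Data.List.Relation.Unary.Any using (here; there)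
open import Function using (_∘_)
open import Relation.Binary.Bundles using (Setoid)
open import Relation.Binary.PropositionalEquality using (_≡_; refl; cong; sym)
import Relation.Binary.Reasoning.Setoid as SetoidReasoning

module _ {τ : Signature} {U : Theory τ} where

  ⊢-resp : ∀ {a b a′ b′} → U ⊢ (a , a′) → U ⊢ (b , b′) → U ⊢ (a , b) → U ⊢ (a′ , b′)
  ⊢-resp a≈a′ b≈b′ a≈b = trans≈ (sym≈ a≈a′) (trans≈ a≈b b≈b′)

  ≡⇒⊢ : ∀ {a b} → a ≡ b → U ⊢ (a , b)
  ≡⇒⊢ refl = refl≈

  ⟪⟫-cong : ∀ {A} (s : Term τ A) {γ δ : A → Term τ ℕ} →
            (∀ a → U ⊢ (γ a , δ a)) → U ⊢ (s ⟪ γ ⟫ , s ⟪ δ ⟫)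
  ⟪⟫-cong (var a)    γ≈δ = γ≈δ a
  ⟪⟫-cong (app f ts) γ≈δ = cong≈ f (λ i → ⟪⟫-cong (ts i) γ≈δ)

  ⟪⟫-⟪⟫ : ∀ {A B} (s : Term τ A) {ρ : A → Term τ B} {γ : B → Term τ ℕ} {δ : A → Term τ ℕ} →
          (∀ a → U ⊢ (ρ a ⟪ γ ⟫ , δ a)) → U ⊢ (s ⟪ ρ ⟫ ⟪ γ ⟫ , s ⟪ δ ⟫)
  ⟪⟫-⟪⟫ (var a)    ρ⟪γ⟫≈δ = ρ⟪γ⟫≈δ a
  ⟪⟫-⟪⟫ (app f ts) ρ⟪γ⟫≈δ = cong≈ f (λ i → ⟪⟫-⟪⟫ (ts i) ρ⟪γ⟫≈δ)

  ⟪⟫-⟪⟫-⟪⟫ : ∀ {A B C} (s : Term τ A) {ρ : A → Term τ B} {γ : B → Term τ C} {δ : A → Term τ C}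
             {ε : C → Term τ ℕ} → (∀ a → ρ a ⟪ γ ⟫ ≡ δ a) → U ⊢ (s ⟪ ρ ⟫ ⟪ γ ⟫ ⟪ ε ⟫ , s ⟪ δ ⟫ ⟪ ε ⟫)
  ⟪⟫-⟪⟫-⟪⟫ (var a)    {ε = ε} ρ⟪γ⟫≡δ = ≡⇒⊢ (cong (_⟪ ε ⟫) (ρ⟪γ⟫≡δ a))
  ⟪⟫-⟪⟫-⟪⟫ (app f ts)         ρ⟪γ⟫≡δ = cong≈ f (λ i → ⟪⟫-⟪⟫-⟪⟫ (ts i) ρ⟪γ⟫≡δ)

  ⊢-fuse : ∀ {A B C} {E : Equation τ A} {ρ : A → Term τ B} {γ : B → Term τ C} {δ : A → Term τ C}
           {ε : C → Term τ ℕ} → (∀ a → ρ a ⟪ γ ⟫ ≡ δ a) →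
           U ⊢ E ⟪ ρ ⟫ₑ ⟪ γ ⟫ₑ ⟪ ε ⟫ₑ → U ⊢ E ⟪ δ ⟫ₑ ⟪ ε ⟫ₑ
  ⊢-fuse {E = l , r} ρ⟪γ⟫≡δ = ⊢-resp (⟪⟫-⟪⟫-⟪⟫ l ρ⟪γ⟫≡δ) (⟪⟫-⟪⟫-⟪⟫ r ρ⟪γ⟫≡δ)

  ⊢-unfuse : ∀ {A B C} {E : Equation τ A} {ρ : A → Term τ B} {γ : B → Term τ C} {δ : A → Term τ C}
             {ε : C → Term τ ℕ} → (∀ a → ρ a ⟪ γ ⟫ ≡ δ a) →
             U ⊢ E ⟪ δ ⟫ₑ ⟪ ε ⟫ₑ → U ⊢ E ⟪ ρ ⟫ₑ ⟪ γ ⟫ₑ ⟪ ε ⟫ₑ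
  ⊢-unfuse {E = l , r} ρ⟪γ⟫≡δ = ⊢-resp (sym≈ (⟪⟫-⟪⟫-⟪⟫ l ρ⟪γ⟫≡δ)) (sym≈ (⟪⟫-⟪⟫-⟪⟫ r ρ⟪γ⟫≡δ))

⊢-setoid : ∀ {τ} → Theory τ → Setoid _ _
⊢-setoid {τ} U = record
  { Carrier       = Term τ ℕ
  ; _≈_           = λ s u → U ⊢ (s , u)
  ; isEquivalence = record { refl = refl≈ ; sym = sym≈ ; trans = trans≈ }
  }

record Translation {σ τ : Signature} (S : Theory σ) (U : Theory τ) : Set where
  field
    ⌜_⌝      : Term σ ℕ → Term τ ℕ
    ⌜_⌝ˢ     : (ℕ → Term σ ℕ) → ℕ → Term τ ℕ
    ⌜⌝-cong  : ∀ f {ss ts : Fin (ar σ f) → Term σ ℕ} →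
               (∀ i → U ⊢ (⌜ ss i ⌝ , ⌜ ts i ⌝)) → U ⊢ (⌜ app f ss ⌝ , ⌜ app f ts ⌝)
    ⌜⌝-⟪⟫    : ∀ s ρ → U ⊢ (⌜ s ⟪ ρ ⟫ ⌝ , ⌜ s ⌝ ⟪ ⌜ ρ ⌝ˢ ⟫)
    ⌜⌝-axiom : ∀ {e} → S e → U ⊢ (⌜ proj₁ e ⌝ , ⌜ proj₂ e ⌝)

  translate : ∀ {e} → S ⊢ e → U ⊢ (⌜ proj₁ e ⌝ , ⌜ proj₂ e ⌝)
  translate (axiom ax)    = ⌜⌝-axiom ax
  translate refl≈         = refl≈
  translate (sym≈ d)      = sym≈ (translate d)
  translate (trans≈ d d′) = trans≈ (translate d) (translate d′)
  translate (cong≈ f ds)  = ⌜⌝-cong f (λ i → translate (ds i))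
  translate (subst≈ {s} {u} ρ d) =
    ⊢-resp (sym≈ (⌜⌝-⟪⟫ s ρ)) (sym≈ (⌜⌝-⟪⟫ u ρ)) (subst≈ ⌜ ρ ⌝ˢ (translate d))

prepend : ∀ {A : Set} {m} → (Fin m → A) → (ℕ → A) → ℕ → A
prepend {m = zero}  γ g y       = g y
prepend {m = suc m} γ g zero    = γ zero
prepend {m = suc m} γ g (suc y) = prepend (γ ∘ suc) g y

prepend-toℕ : ∀ {A : Set} {m} (γ : Fin m → A) (g : ℕ → A) (i : Fin m) → prepend γ g (toℕ i) ≡ γ i
prepend-toℕ γ g zero    = refl
prepend-toℕ γ g (suc i) = prepend-toℕ (γ ∘ suc) g i

prepend-+ : ∀ {A : Set} m (γ : Fin m → A) (g : ℕ → A) (x : ℕ) → prepend γ g (m + x) ≡ g x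
prepend-+ zero    γ g x = refl
prepend-+ (suc m) γ g x = prepend-+ m (γ ∘ suc) g x

consts : ∀ {σ n} → Fin n → Term (withConsts σ) ℕ
consts i = fresh (toℕ i)

infix 4 _⊩_at_

_⊩_at_ : ∀ {σ A} → Theory (withConsts σ) → Equation σ A → (A → Term (withConsts σ) ℕ) → Set
U ⊩ E at γ = U ⊢ liftE E ⟪ γ ⟫ₑ

_⟦_,_⟧ : ∀ {σ} → Term σ (Fin 2) → Term (withConsts σ) ℕ → Term (withConsts σ) ℕ → Term (withConsts σ) ℕ
t ⟦ u , w ⟧ = liftT t ⟪ ⟨ u , w ⟩ ⟫

module _ {σ : Signature} {U : Theory (withConsts σ)} where

  liftT-⟪⟫ : ∀ {A} (s : Term σ A) (ρ : A → Term σ ℕ) → U ⊢ (liftT (s ⟪ ρ ⟫) , liftT s ⟪ liftT ∘ ρ ⟫)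
  liftT-⟪⟫ (var a)    ρ = refl≈
  liftT-⟪⟫ (app f ts) ρ = cong≈ (inj₁ f) (λ i → liftT-⟪⟫ (ts i) ρ)

  liftT-⟪⟫-⟪⟫ : ∀ {A B} (s : Term σ A) {ρ : A → Term σ B} {γ : B → Term (withConsts σ) ℕ}
                {δ : A → Term (withConsts σ) ℕ} →
                (∀ a → U ⊢ (liftT (ρ a) ⟪ γ ⟫ , δ a)) → U ⊢ (liftT (s ⟪ ρ ⟫) ⟪ γ ⟫ , liftT s ⟪ δ ⟫)
  liftT-⟪⟫-⟪⟫ (var a)    ρ⟪γ⟫≈δ = ρ⟪γ⟫≈δ a
  liftT-⟪⟫-⟪⟫ (app f ts) ρ⟪γ⟫≈δ = cong≈ (inj₁ f) (λ i → liftT-⟪⟫-⟪⟫ (ts i) ρ⟪γ⟫≈δ)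

  ⊩-⟪⟫ : ∀ {A B} {E : Equation σ A} {ρ : A → Term σ B} {γ δ} →
         (∀ a → U ⊢ (liftT (ρ a) ⟪ γ ⟫ , δ a)) → U ⊩ E ⟪ ρ ⟫ₑ at γ → U ⊩ E at δ
  ⊩-⟪⟫ {E = l , r} ρ⟪γ⟫≈δ = ⊢-resp (liftT-⟪⟫-⟪⟫ l ρ⟪γ⟫≈δ) (liftT-⟪⟫-⟪⟫ r ρ⟪γ⟫≈δ)

  ⊩-⟪⟫⁻ : ∀ {A B} {E : Equation σ A} {ρ : A → Term σ B} {γ δ} →
          (∀ a → U ⊢ (liftT (ρ a) ⟪ γ ⟫ , δ a)) → U ⊩ E at δ → U ⊩ E ⟪ ρ ⟫ₑ at γ
  ⊩-⟪⟫⁻ {E = l , r} ρ⟪γ⟫≈δ = ⊢-resp (sym≈ (liftT-⟪⟫-⟪⟫ l ρ⟪γ⟫≈δ)) (sym≈ (liftT-⟪⟫-⟪⟫ r ρ⟪γ⟫≈δ))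

  ⟦⟧-cong : ∀ (t : Term σ (Fin 2)) {u u′ w w′} →
            U ⊢ (u , u′) → U ⊢ (w , w′) → U ⊢ (t ⟦ u , w ⟧ , t ⟦ u′ , w′ ⟧)
  ⟦⟧-cong t u≈u′ w≈w′ = ⟪⟫-cong (liftT t) λ { zero → u≈u′ ; (suc zero) → w≈w′ }

  liftT-[] : ∀ {A} (t : Term σ (Fin 2)) (u w : Term σ A) (γ : A → Term (withConsts σ) ℕ) →
             U ⊢ (liftT (t [ u , w ]) ⟪ γ ⟫ , t ⟦ liftT u ⟪ γ ⟫ , liftT w ⟪ γ ⟫ ⟧)
  liftT-[] t u w γ = liftT-⟪⟫-⟪⟫ t λ { zero → refl≈ ; (suc zero) → refl≈ }

module _ {σ : Signature} {T : Theory σ} {n} {T′ : List (Equation σ (Fin n))} where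

  lift : Translation T (Extend T T′)
  lift = record
    { ⌜_⌝      = liftT
    ; ⌜_⌝ˢ     = λ ρ → liftT ∘ ρ
    ; ⌜⌝-cong  = λ f → cong≈ (inj₁ f)
    ; ⌜⌝-⟪⟫    = liftT-⟪⟫
    ; ⌜⌝-axiom = λ ax → axiom (base ax)
    }

  ⊢-at : ∀ {m} {E : Equation σ (Fin m)} → T ⊢ embed E → (γ : Fin m → Term (withConsts σ) ℕ) →
         Extend T T′ ⊩ E at γ
  ⊢-at {E = E} ⊢E γ =
    ⊩-⟪⟫ {E = E} (λ i → ≡⇒⊢ (prepend-toℕ γ var i))
                 (subst≈ (prepend γ var) (Translation.translate lift ⊢E))

module _ {σ : Signature} where

  renameConsts : (ℕ → ℕ) → Term (withConsts σ) ℕ → Term (withConsts σ) ℕ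
  renameConsts κ (var x)           = var x
  renameConsts κ (app (inj₁ f) ts) = app (inj₁ f) (λ i → renameConsts κ (ts i))
  renameConsts κ (app (inj₂ k) _)  = fresh (κ k)

  module _ {U : Theory (withConsts σ)} (κ : ℕ → ℕ) where

    renameConsts-⟪⟫ : ∀ s ρ → U ⊢ (renameConsts κ (s ⟪ ρ ⟫) , renameConsts κ s ⟪ renameConsts κ ∘ ρ ⟫)
    renameConsts-⟪⟫ (var x)           ρ = refl≈
    renameConsts-⟪⟫ (app (inj₁ f) ts) ρ = cong≈ (inj₁ f) (λ i → renameConsts-⟪⟫ (ts i) ρ)
    renameConsts-⟪⟫ (app (inj₂ k) ts) ρ = cong≈ (inj₂ (κ k)) (λ ())

    renameConsts-liftT : (s : Term σ ℕ) → U ⊢ (renameConsts κ (liftT s) , liftT s)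
    renameConsts-liftT (var x)    = refl≈
    renameConsts-liftT (app f ts) = cong≈ (inj₁ f) (λ i → renameConsts-liftT (ts i))

    renameConsts-liftT-⟪⟫ : ∀ {A} (s : Term σ A) (γ : A → Term (withConsts σ) ℕ) →
                            U ⊢ (renameConsts κ (liftT s ⟪ γ ⟫) , liftT s ⟪ renameConsts κ ∘ γ ⟫)
    renameConsts-liftT-⟪⟫ (var a)    γ = refl≈
    renameConsts-liftT-⟪⟫ (app f ts) γ = cong≈ (inj₁ f) (λ i → renameConsts-liftT-⟪⟫ (ts i) γ)

module _ {σ : Signature} {T : Theory σ} {n₁ n₂} {T₁ : List (Equation σ (Fin n₁))}
         {T₂ : List (Equation σ (Fin n₂))} (κ : ℕ → ℕ) where

  private
    κ-consts : ∀ {m} → Fin m → Term (withConsts σ) ℕ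
    κ-consts i = fresh (κ (toℕ i))

  constsRenaming : All (λ Q → Extend T T₂ ⊩ Q at κ-consts) T₁ → Translation (Extend T T₁) (Extend T T₂)
  constsRenaming hyps = record
    { ⌜_⌝      = renameConsts κ
    ; ⌜_⌝ˢ     = λ ρ → renameConsts κ ∘ ρ
    ; ⌜⌝-cong  = λ { (inj₁ f) → cong≈ (inj₁ f) ; (inj₂ k) _ → refl≈ }
    ; ⌜⌝-⟪⟫    = renameConsts-⟪⟫ κ
    ; ⌜⌝-axiom = renamed-axiom
    }
    where
    renamed-axiom : ∀ {e} → Extend T T₁ e →
                    Extend T T₂ ⊢ (renameConsts κ (proj₁ e) , renameConsts κ (proj₂ e))
    renamed-axiom (base {l , r} ax) =
      ⊢-resp (sym≈ (renameConsts-liftT κ l)) (sym≈ (renameConsts-liftT κ r)) (axiom (base ax))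
    renamed-axiom (hyp {l , r} Q∈T₁) =
      ⊢-resp (sym≈ (renameConsts-liftT-⟪⟫ κ l consts)) (sym≈ (renameConsts-liftT-⟪⟫ κ r consts))
             (All.lookup hyps Q∈T₁)

  ⇒-rename : ∀ {E : Equation σ (Fin n₁)} → T ⊢ T₁ ⇒ E →
             All (λ Q → Extend T T₂ ⊩ Q at κ-consts) T₁ → Extend T T₂ ⊩ E at κ-consts
  ⇒-rename {l , r} d hyps =
    ⊢-resp (renameConsts-liftT-⟪⟫ κ l consts) (renameConsts-liftT-⟪⟫ κ r consts)
           (Translation.translate (constsRenaming hyps) d)

module _ {σ : Signature} {T : Theory σ} {n m} {T′ : List (Equation σ (Fin n))}
         (θ : Fin n → Term σ (Fin (suc m))) where

  private
    e : Fin (suc m) → Term σ ℕ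
    e i = var (toℕ i)

    -- constants occurring in no hypothesis may denote anything; we send them to x₀
    θ∞ : ℕ → Term σ (Fin (suc m))
    θ∞ = prepend θ (λ _ → var zero)

  -- Variables of the derivation are shifted past the parameters x₀ … xₘ of θ,
  -- so that its substitutions never capture them.
  eliminateConsts : Term (withConsts σ) ℕ → Term σ ℕ
  eliminateConsts (var x)           = var (suc m + x)
  eliminateConsts (app (inj₁ f) ts) = app f (λ i → eliminateConsts (ts i))
  eliminateConsts (app (inj₂ k) _)  = θ∞ k ⟪ e ⟫

  eliminateConsts-⟪⟫ : ∀ s ρ → T ⊢ (eliminateConsts (s ⟪ ρ ⟫) ,
                                    eliminateConsts s ⟪ prepend e (eliminateConsts ∘ ρ) ⟫)
  eliminateConsts-⟪⟫ (var x) ρ = ≡⇒⊢ (sym (prepend-+ (suc m) e (eliminateConsts ∘ ρ) x))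
  eliminateConsts-⟪⟫ (app (inj₁ f) ts) ρ = cong≈ f (λ i → eliminateConsts-⟪⟫ (ts i) ρ)
  eliminateConsts-⟪⟫ (app (inj₂ k) ts) ρ =
    sym≈ (⟪⟫-⟪⟫ (θ∞ k) (λ i → ≡⇒⊢ (prepend-toℕ e (eliminateConsts ∘ ρ) i)))

  eliminateConsts-liftT : (s : Term σ ℕ) →
                          T ⊢ (eliminateConsts (liftT s) , s ⟪ (λ x → var (suc m + x)) ⟫)
  eliminateConsts-liftT (var x)    = refl≈
  eliminateConsts-liftT (app f ts) = cong≈ f (λ i → eliminateConsts-liftT (ts i))

  eliminateConsts-ground : (s : Term σ (Fin n)) →
                           T ⊢ (eliminateConsts (liftT s ⟪ consts ⟫) , s ⟪ θ ⟫ ⟪ e ⟫)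
  eliminateConsts-ground (var i)    = ≡⇒⊢ (cong (_⟪ e ⟫) (prepend-toℕ θ (λ _ → var zero) i))
  eliminateConsts-ground (app f ts) = cong≈ f (λ i → eliminateConsts-ground (ts i))

  constsElimination : All (λ Q → T ⊢ embed (Q ⟪ θ ⟫ₑ)) T′ → Translation (Extend T T′) T
  constsElimination hyps = record
    { ⌜_⌝      = eliminateConsts
    ; ⌜_⌝ˢ     = λ ρ → prepend e (eliminateConsts ∘ ρ)
    ; ⌜⌝-cong  = λ { (inj₁ f) → cong≈ f ; (inj₂ k) _ → refl≈ }
    ; ⌜⌝-⟪⟫    = eliminateConsts-⟪⟫
    ; ⌜⌝-axiom = eliminated-axiom
    }
    where
    eliminated-axiom : ∀ {e} → Extend T T′ e →
                       T ⊢ (eliminateConsts (proj₁ e) , eliminateConsts (proj₂ e))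
    eliminated-axiom (base {l , r} ax) =
      ⊢-resp (sym≈ (eliminateConsts-liftT l)) (sym≈ (eliminateConsts-liftT r))
             (subst≈ (λ x → var (suc m + x)) (axiom ax))
    eliminated-axiom (hyp {l , r} Q∈T′) =
      ⊢-resp (sym≈ (eliminateConsts-ground l)) (sym≈ (eliminateConsts-ground r)) (All.lookup hyps Q∈T′)

  ⇒-discharge : ∀ {E : Equation σ (Fin n)} → T ⊢ T′ ⇒ E →
                All (λ Q → T ⊢ embed (Q ⟪ θ ⟫ₑ)) T′ → T ⊢ embed (E ⟪ θ ⟫ₑ)
  ⇒-discharge {l , r} d hyps =
    ⊢-resp (eliminateConsts-ground l) (eliminateConsts-ground r)
           (Translation.translate (constsElimination hyps) d)

-- T ⊢ E gives E for the constants a₀, a₁, …; discharging them yields the instance.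
⊢-instance : ∀ {σ} {T : Theory σ} {n m} {E : Equation σ (Fin n)} (θ : Fin n → Term σ (Fin (suc m))) →
             T ⊢ embed E → T ⊢ embed (E ⟪ θ ⟫ₑ)
⊢-instance {E = E} θ ⊢E = ⇒-discharge θ {E} (⊢-at {T′ = []} {E = E} ⊢E consts) []

t[t,x]⟦u,w⟧≈u : ∀ {σ} {U : Theory (withConsts σ)} (t : Term σ (Fin 2)) {u w} →
                  U ⊢ (t ⟦ u , w ⟧ , w) → U ⊢ (t ⟦ w , u ⟧ , u) → U ⊢ (t [ t , x₂ ] ⟦ u , w ⟧ , u)
t[t,x]⟦u,w⟧≈u {U = U} t {u} {w} t⟦u,w⟧≈w t⟦w,u⟧≈u = begin
  t [ t , x₂ ] ⟦ u , w ⟧   ≈⟨ liftT-[] t t x₂ (⟨ u , w ⟩) ⟩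
  t ⟦ t ⟦ u , w ⟧ , u ⟧    ≈⟨ ⟦⟧-cong t t⟦u,w⟧≈w refl≈ ⟩
  t ⟦ w , u ⟧              ≈⟨ t⟦w,u⟧≈u ⟩
  u                        ∎
  where open SetoidReasoning (⊢-setoid U)

module _ {σ : Signature} {T : Theory σ} {P : Equation σ (Fin 2)} (t : Term σ (Fin 2))
         (semi : SemiDetermined T P t) where

  semi-determined-at : ∀ {n} {T′ : List (Equation σ (Fin n))} (κ : ℕ → ℕ) →
            Extend T T′ ⊩ P at (λ i → fresh (κ (toℕ i))) →
            Extend T T′ ⊢ (t ⟦ fresh (κ 0) , fresh (κ 1) ⟧ , fresh (κ 1))
  semi-determined-at κ P-at = trans≈ (⟪⟫-cong (liftT t) λ { zero → refl≈ ; (suc zero) → refl≈ })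
                          (⇒-rename κ {t , y₂} semi (P-at ∷ []))

  t-instance⇒conditional : ∀ {E : Equation σ (Fin 2)} → T ⊢ embed (E [ x₂ , t ]ₑ) → T ⊢ (P ∷ []) ⇒ E
  t-instance⇒conditional {E} ⊢E[x,t] =
    ⊩-⟪⟫ {E = E} (λ { zero → refl≈ ; (suc zero) → semi }) (⊢-at {E = E [ x₂ , t ]ₑ} ⊢E[x,t] consts)

  v-antisymmetric : (T ⊢ embed (t [ t , x₂ ] , t [ t , x₂ ] [ y₂ , x₂ ]) ⊎
                     T ⊢ embed (t [ t , x₂ ] , t [ t [ t , x₂ ] , y₂ ])) →
                    T ⊢ (P ∷ P [ y₂ , x₂ ]ₑ ∷ []) ⇒ (x₂ , y₂)
  v-antisymmetric = a≈b
    where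
    U : Theory (withConsts σ)
    U = Extend T (P ∷ P [ y₂ , x₂ ]ₑ ∷ [])

    a b : Term (withConsts σ) ℕ
    a = fresh 0
    b = fresh 1

    v : Term σ (Fin 2)
    v = t [ t , x₂ ]

    t⟦a,b⟧≈b : U ⊢ (t ⟦ a , b ⟧ , b)
    t⟦a,b⟧≈b = semi-determined-at (λ k → k) (axiom (hyp (here refl)))

    t⟦b,a⟧≈a : U ⊢ (t ⟦ b , a ⟧ , a)
    t⟦b,a⟧≈a = semi-determined-at (λ { zero → 1 ; (suc _) → 0 })
                       (⊩-⟪⟫ {E = P} (λ { zero → refl≈ ; (suc zero) → refl≈ })
                             (axiom (hyp (there (here refl)))))

    v⟦a,b⟧≈a : U ⊢ (v ⟦ a , b ⟧ , a)
    v⟦a,b⟧≈a = t[t,x]⟦u,w⟧≈u t t⟦a,b⟧≈b t⟦b,a⟧≈a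

    open SetoidReasoning (⊢-setoid U)

    a≈b : (T ⊢ embed (v , v [ y₂ , x₂ ]) ⊎ T ⊢ embed (v , t [ v , y₂ ])) → U ⊢ (a , b)
    a≈b (inj₁ ⊢v≈v[y,x]) = begin
      a                        ≈⟨ sym≈ v⟦a,b⟧≈a ⟩
      v ⟦ a , b ⟧              ≈⟨ ⊢-at {E = v , v [ y₂ , x₂ ]} ⊢v≈v[y,x] (⟨ a , b ⟩) ⟩
      v [ y₂ , x₂ ] ⟦ a , b ⟧  ≈⟨ liftT-[] v y₂ x₂ (⟨ a , b ⟩) ⟩
      v ⟦ b , a ⟧              ≈⟨ t[t,x]⟦u,w⟧≈u t t⟦b,a⟧≈a t⟦a,b⟧≈b ⟩
      b                        ∎
    a≈b (inj₂ ⊢v≈t[v,y]) = begin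
      a                        ≈⟨ sym≈ v⟦a,b⟧≈a ⟩
      v ⟦ a , b ⟧              ≈⟨ ⊢-at {E = v , t [ v , y₂ ]} ⊢v≈t[v,y] (⟨ a , b ⟩) ⟩
      t [ v , y₂ ] ⟦ a , b ⟧   ≈⟨ liftT-[] t v y₂ (⟨ a , b ⟩) ⟩
      t ⟦ v ⟦ a , b ⟧ , b ⟧    ≈⟨ ⟦⟧-cong t v⟦a,b⟧≈a refl≈ ⟩
      t ⟦ a , b ⟧              ≈⟨ t⟦a,b⟧≈b ⟩
      b                        ∎

  t-transitive : T ⊢ embed (P [ x₃ , t [ t [ x₃ , y₃ ] , z₃ ] ]ₑ) →
                 T ⊢ (P [ x₃ , y₃ ]ₑ ∷ P [ y₃ , z₃ ]ₑ ∷ []) ⇒ P [ x₃ , z₃ ]ₑ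
  t-transitive ⊢P[x,t[t[x,y],z]] =
    ⊩-⟪⟫⁻ {E = P} x,z↦a,c
          (⊩-⟪⟫ {E = P} x,t[t[x,y],z]↦a,c
                (⊢-at {E = P [ x₃ , t [ t [ x₃ , y₃ ] , z₃ ] ]ₑ} ⊢P[x,t[t[x,y],z]] consts))
    where
    U : Theory (withConsts σ)
    U = Extend T (P [ x₃ , y₃ ]ₑ ∷ P [ y₃ , z₃ ]ₑ ∷ [])

    a b c : Term (withConsts σ) ℕ
    a = fresh 0
    b = fresh 1
    c = fresh 2

    t⟦a,b⟧≈b : U ⊢ (t ⟦ a , b ⟧ , b)
    t⟦a,b⟧≈b = semi-determined-at (λ k → k)
                       (⊩-⟪⟫ {E = P} (λ { zero → refl≈ ; (suc zero) → refl≈ }) (axiom (hyp (here refl))))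

    t⟦b,c⟧≈c : U ⊢ (t ⟦ b , c ⟧ , c)
    t⟦b,c⟧≈c = semi-determined-at suc
                       (⊩-⟪⟫ {E = P} (λ { zero → refl≈ ; (suc zero) → refl≈ })
                             (axiom (hyp (there (here refl)))))

    x,t[t[x,y],z]↦a,c : ∀ i → U ⊢ (liftT (⟨ x₃ , t [ t [ x₃ , y₃ ] , z₃ ] ⟩ i) ⟪ consts ⟫ , ⟨ a , c ⟩ i)
    x,t[t[x,y],z]↦a,c zero       = refl≈
    x,t[t[x,y],z]↦a,c (suc zero) = begin
      liftT (t [ t [ x₃ , y₃ ] , z₃ ]) ⟪ consts ⟫  ≈⟨ liftT-[] t (t [ x₃ , y₃ ]) z₃ consts ⟩
      t ⟦ liftT (t [ x₃ , y₃ ]) ⟪ consts ⟫ , c ⟧  ≈⟨ ⟦⟧-cong t (liftT-[] t x₃ y₃ consts) refl≈ ⟩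
      t ⟦ t ⟦ a , b ⟧ , c ⟧                       ≈⟨ ⟦⟧-cong t t⟦a,b⟧≈b refl≈ ⟩
      t ⟦ b , c ⟧                                 ≈⟨ t⟦b,c⟧≈c ⟩
      c                                           ∎
      where open SetoidReasoning (⊢-setoid U)

    x,z↦a,c : ∀ i → U ⊢ (liftT (⟨ x₃ , z₃ ⟩ i) ⟪ consts ⟫ , ⟨ a , c ⟩ i)
    x,z↦a,c zero       = refl≈
    x,z↦a,c (suc zero) = refl≈

transitive⇒t-transitive : ∀ {σ} {T : Theory σ} {P : Equation σ (Fin 2)} (t : Term σ (Fin 2)) →
  T ⊢ embed (P [ x₂ , t ]ₑ) →
  T ⊢ (P [ x₃ , y₃ ]ₑ ∷ P [ y₃ , z₃ ]ₑ ∷ []) ⇒ P [ x₃ , z₃ ]ₑ →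
  T ⊢ embed (P [ x₃ , t [ t [ x₃ , y₃ ] , z₃ ] ]ₑ)
transitive⇒t-transitive {σ} {T} {P} t ⊢P[x,t] ⊢x≤y∧y≤z⇒x≤z =
  ⊢-fuse {E = P} {⟨ x₃ , z₃ ⟩} {θ} (λ { zero → refl ; (suc zero) → refl })
         (⇒-discharge θ {P [ x₃ , z₃ ]ₑ} ⊢x≤y∧y≤z⇒x≤z (⊢P[x,t[x,y]] ∷ ⊢P[t[x,y],t[t[x,y],z]] ∷ []))
  where
  θ : Fin 3 → Term σ (Fin 3)
  θ zero             = x₃
  θ (suc zero)       = t [ x₃ , y₃ ]
  θ (suc (suc zero)) = t [ t [ x₃ , y₃ ] , z₃ ]

  ⊢P[u,t[u,w]] : (u w : Term σ (Fin 3)) → T ⊢ embed (P [ u , t [ u , w ] ]ₑ)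
  ⊢P[u,t[u,w]] u w = ⊢-fuse {E = P} {⟨ x₂ , t ⟩} {⟨ u , w ⟩} (λ { zero → refl ; (suc zero) → refl })
                            (⊢-instance {E = P [ x₂ , t ]ₑ} ⟨ u , w ⟩ ⊢P[x,t])

  ⊢P[x,t[x,y]] : T ⊢ embed (P [ x₃ , y₃ ]ₑ ⟪ θ ⟫ₑ)
  ⊢P[x,t[x,y]] = ⊢-unfuse {E = P} {⟨ x₃ , y₃ ⟩} {θ} (λ { zero → refl ; (suc zero) → refl })
                          (⊢P[u,t[u,w]] x₃ y₃)

  ⊢P[t[x,y],t[t[x,y],z]] : T ⊢ embed (P [ y₃ , z₃ ]ₑ ⟪ θ ⟫ₑ)
  ⊢P[t[x,y],t[t[x,y],z]] = ⊢-unfuse {E = P} {⟨ y₃ , z₃ ⟩} {θ} (λ { zero → refl ; (suc zero) → refl })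
                                    (⊢P[u,t[u,w]] (t [ x₃ , y₃ ]) z₃)

mainTheorem1 : (σ : Signature) (T : Theory σ) (P : Equation σ (Fin 2)) (t : Term σ (Fin 2)) →
    SemiDetermined T P t →
    let v : Term σ (Fin 2)
        v = t [ t , x₂ ]
    in
    -- (1)
    ((E : Equation σ (Fin 2)) →
        (T ⊢ embed (E [ x₂ , t ]ₑ) → T ⊢ (P ∷ []) ⇒ E)
      × (StronglyDetermined T P t → T ⊢ (P ∷ []) ⇒ E → T ⊢ embed (E [ x₂ , t ]ₑ)))
    -- (2)
    × (Determined T P t →
        (T ⊢ embed (P [ x₂ , x₂ ]ₑ) → T ⊢ embed (t [ x₂ , x₂ ] , x₂))
      × (T ⊢ embed (t [ x₂ , x₂ ] , x₂) → T ⊢ embed (P [ x₂ , x₂ ]ₑ)))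
    -- (3)
    × ((T ⊢ embed (v , v [ y₂ , x₂ ]) ⊎ T ⊢ embed (v , t [ v , y₂ ])) →
        T ⊢ (P ∷ P [ y₂ , x₂ ]ₑ ∷ []) ⇒ (x₂ , y₂))
    -- (4)
    × ((T ⊢ embed (P [ x₃ , t [ t [ x₃ , y₃ ] , z₃ ] ]ₑ) →
          T ⊢ (P [ x₃ , y₃ ]ₑ ∷ P [ y₃ , z₃ ]ₑ ∷ []) ⇒ P [ x₃ , z₃ ]ₑ)
      × (StronglyDetermined T P t →
          T ⊢ (P [ x₃ , y₃ ]ₑ ∷ P [ y₃ , z₃ ]ₑ ∷ []) ⇒ P [ x₃ , z₃ ]ₑ →
          T ⊢ embed (P [ x₃ , t [ t [ x₃ , y₃ ] , z₃ ] ]ₑ)))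
mainTheorem1 σ T P t semi =
    (λ E → t-instance⇒conditional t semi {E}
         , λ (_ , ⊢P[x,t]) ⊢P⇒E → ⇒-discharge ⟨ x₂ , t ⟩ {E} ⊢P⇒E (⊢P[x,t] ∷ []))
  , (λ (_ , ⊢t≈y⇒P) → (λ ⊢P[x,x] → ⇒-discharge ⟨ x₂ , x₂ ⟩ {t , y₂} semi (⊢P[x,x] ∷ []))
                    , (λ ⊢t[x,x]≈x → ⇒-discharge ⟨ x₂ , x₂ ⟩ {P} ⊢t≈y⇒P (⊢t[x,x]≈x ∷ [])))
  , v-antisymmetric t semi
  , (t-transitive t semi , λ (_ , ⊢P[x,t]) → transitive⇒t-transitive {P = P} t ⊢P[x,t])
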